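{- For any instance of $k$-MCVRP, $\mathrm{OPT}\ge\mathrm{OPT}'\ge c(T^*)$, where $\mathrm{OPT}$ is the optimal cost of the $k$-MCVRP instance, $\mathrm{OPT}'$ is the optimal cost of the corresponding $k$-CVRP instance on $H$ (same demands, same version, single depot $o$), and $T^*$ is a minimum-cost spanning tree of $H$.
   Context: $k$-MCVRP: an instance consists of a complete undirected graph $G=(V\cup D,E)$ with customers $V$ and depots $D$, a symmetric edge weight $w\ge 0$ satisfying the triangle inequality, demands $d(v)\in\mathbb{Z}_{\ge1}$, and a capacity $k$. A tour is a closed walk starting and ending at the same depot, passing through no other depot, delivering at most $k$ units in total to customers on it; a feasible solution is a collection of tours meeting all demands, and its cost is the total weight of traversed edges (with multiplicity). (Versions: splittable, unsplittable—each customer served by one tour—or unit-demand.) $k$-CVRP is the special case with a single depot. Auxiliary graph: $H=(V\cup\{o\},F)$ is the complete graph obtained by replacing all depots by a single depot $o$, with weights $c(o,v)=\min_{u\in D}w(u,v)$ and $c(v,v')=\min\{c(o,v)+c(o,v'),w(v,v')\}$ for $v,v'\in V$.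
   Formalization: The edge weights w take values in the nonnegative rationals instead of ℝ≥0, so the weights c of the auxiliary graph H are rational as well. -}

module Defs where

open import Data.Nat as ℕ using (ℕ; zero; suc)
open import Data.Fin using (Fin)
import Data.Fin as F
open import Data.Unit using (⊤)
open import Data.Sum using (_⊎_; inj₁; inj₂)
open import Data.Product using (Σ; ∃; _×_; _,_; proj₁; proj₂)
open import Data.List using (List; []; _∷_; _++_; [_]; map; foldr; length; allFin)
open import Data.List.Relation.Unary.All using (All)
open import Data.List.Relation.Unary.Any using (Any)
open import Data.List.Membership.Propositional using (_∈_)
open import Data.Rational using (ℚ; 0ℚ; _+_; _≤_; _⊓_)
open import Relation.Binary.PropositionalEquality using (_≡_; _≢_)

-- Vertices of the complete graph G = (V ∪ D, E):
-- customers V = Fin n, depots D = Fin m.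

Vtx : ℕ → ℕ → Set
Vtx n m = Fin n ⊎ Fin m

record Instance (n m : ℕ) : Set where
  field
    w : Vtx n m → Vtx n m → ℚ
    d : Fin n → ℕ
    k : ℕ
open Instance public

data Version : Set where
  splittable unsplittable unitDemand : Version

record ValidInstance {n m : ℕ} (ver : Version) (I : Instance n m) : Set where
  field
    nonneg   : ∀ x y → 0ℚ ≤ w I x y
    symm     : ∀ x y → w I x y ≡ w I y x
    triangle : ∀ x y z → w I x z ≤ w I x y + w I y z
    demand≥1 : ∀ v → 1 ℕ.≤ d I v
    unitDem  : ver ≡ unitDemand → ∀ v → d I v ≡ 1

sumℕ : List ℕ → ℕ
sumℕ = foldr ℕ._+_ 0

sumℚ : List ℚ → ℚ
sumℚ = foldr _+_ 0ℚ

ΣV : {n : ℕ} → (Fin n → ℕ) → ℕ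
ΣV {n} f = sumℕ (map f (allFin n))

-- Consecutive vertices of a walk in a (loopless) complete graph are distinct.
StepsDistinct : {A : Set} → List A → Set
StepsDistinct []           = ⊤
StepsDistinct (x ∷ [])     = ⊤
StepsDistinct (x ∷ y ∷ xs) = (x ≢ y) × StepsDistinct (y ∷ xs)

walkCost : {A : Set} → (A → A → ℚ) → List A → ℚ
walkCost c []           = 0ℚ
walkCost c (x ∷ [])     = 0ℚ
walkCost c (x ∷ y ∷ xs) = c x y + walkCost c (y ∷ xs)

record Tour (n m k : ℕ) : Set where
  field
    depot     : Fin m
    inner     : List (Vtx n m)
    del       : Fin n → ℕ
    noOtherDepot : All (λ x → ∀ u → x ≡ inj₂ u → u ≡ depot) inner
    isWalk    : StepsDistinct (inj₂ depot ∷ inner ++ [ inj₂ depot ])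
    delVisited : ∀ v → del v ≢ 0 → inj₁ v ∈ inner
    capacity  : ΣV del ℕ.≤ k
open Tour public

walkOf : {n m k : ℕ} → Tour n m k → List (Vtx n m)
walkOf t = inj₂ (depot t) ∷ inner t ++ [ inj₂ (depot t) ]

Solution : (n m : ℕ) → Instance n m → Set
Solution n m I = List (Tour n m (k I))

cost : {n m : ℕ} (I : Instance n m) → Solution n m I → ℚ
cost I S = sumℚ (map (λ t → walkCost (w I) (walkOf t)) S)

Feasible : {n m : ℕ} → Version → (I : Instance n m) → Solution n m I → Set
Feasible {n} ver I S =
  (∀ v → sumℕ (map (λ t → del t v) S) ≡ d I v) ×
  (ver ≡ unsplittable → ∀ v → Any (λ t → del t v ≡ d I v) S)

-- The auxiliary graph H = (V ∪ {o}, F): single depot o (= the unique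
-- element of Fin 1).

minFin : {m : ℕ} → (Fin (suc m) → ℚ) → ℚ
minFin {zero}  f = f F.zero
minFin {suc m} f = f F.zero ⊓ minFin (λ i → f (F.suc i))

cO : {n m : ℕ} → Instance n (suc m) → Fin n → ℚ
cO I v = minFin (λ u → w I (inj₂ u) (inj₁ v))

-- weights of H; the value c(o,o) is never used (there is no edge oo)
cH : {n m : ℕ} → Instance n (suc m) → Vtx n 1 → Vtx n 1 → ℚ
cH I (inj₁ v) (inj₁ v') = (cO I v + cO I v') ⊓ w I (inj₁ v) (inj₁ v')
cH I (inj₁ v) (inj₂ _)  = cO I v
cH I (inj₂ _) (inj₁ v)  = cO I v
cH I (inj₂ _) (inj₂ _)  = 0ℚ

HInst : {n m : ℕ} → Instance n (suc m) → Instance n 1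
HInst I = record { w = cH I ; d = d I ; k = k I }

-- Spanning trees of H (edge lists; an edge (x , y) is undirected)

Adjacent : {A : Set} → List (A × A) → A → A → Set
Adjacent T x y = ((x , y) ∈ T) ⊎ ((y , x) ∈ T)

data Reach {A : Set} (T : List (A × A)) : A → A → Set where
  here : ∀ {x} → Reach T x x
  step : ∀ {x y z} → Adjacent T x y → Reach T y z → Reach T x z

-- A spanning tree of H (which has n + 1 vertices): a connected spanning
-- subgraph with no loops and exactly |V(H)| - 1 = n edges.
IsSpanningTree : (n : ℕ) → List (Vtx n 1 × Vtx n 1) → Set
IsSpanningTree n T =
  All (λ e → proj₁ e ≢ proj₂ e) T ×
  (length T ≡ n) ×
  (∀ x y → Reach T x y)

treeCost : {A : Set} → (A → A → ℚ) → List (A × A) → ℚ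
treeCost c T = sumℚ (map (λ e → c (proj₁ e) (proj₂ e)) T)

IsMST : {n m : ℕ} → Instance n (suc m) → List (Vtx n 1 × Vtx n 1) → Set
IsMST {n} I T =
  IsSpanningTree n T ×
  (∀ T' → IsSpanningTree n T' → treeCost (cH I) T ≤ treeCost (cH I) T')

-- Collapsing all depots to the single depot o maps every tour of G to a
-- tour of H that is no more expensive edge by edge, since c(o,v) and
-- c(v,v') are minima over the corresponding edges of G; so OPT ≥ OPT'.
-- The tours of a feasible solution on H, all starting at o, form a
-- connected spanning multigraph of H. Scanning their edges in order and
-- keeping the first edge entering each vertex yields a spanning tree (one
-- edge per customer) whose cost, as c ≥ 0, is at most the cost of the
-- solution; so OPT' ≥ c(T*).
module Submission where

open import Defs
open import Data.Nat using (ℕ; suc)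
open import Data.Product using (Σ; _×_)
open import Data.Rational using (_≤_)

import Data.Nat as ℕ
open import Data.Fin as F using (Fin)
open import Data.Unit using (⊤; tt)
open import Data.Empty using (⊥-elim)
open import Data.Sum using (_⊎_; inj₁; inj₂)
open import Data.Sum.Properties using (≡-dec; inj₁-injective)
open import Data.Product using (_,_; proj₁; proj₂; ∃)
open import Data.List using (List; []; _∷_; _++_; [_]; map; length; allFin)
open import Data.List.Properties using (map-++; length-map; length-tabulate)
open import Data.List.Relation.Unary.All as All using (All; []; _∷_)
open import Data.List.Relation.Unary.All.Properties using (++⁺)
open import Data.List.Relation.Unary.Any using (Any; here; there)
open import Data.List.Relation.Unary.AllPairs using ([]; _∷_)
open import Data.List.Relation.Unary.Unique.Propositional using (Unique)
open import Data.List.Relation.Unary.Unique.Propositional.Properties using (allFin⁺)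
  renaming (map⁺ to Unique-map⁺)
open import Data.List.Relation.Binary.Sublist.Propositional using (_⊆_; []; _∷_; _∷ʳ_)
open import Data.List.Relation.Binary.Sublist.Propositional.Properties using (All-resp-⊆)
open import Data.List.Membership.Propositional using (_∈_; _∉_)
open import Data.List.Membership.Propositional.Properties
  using (∈-map⁺; ∈-map⁻; ∈-++⁺ˡ; ∈-++⁺ʳ; ∈-allFin)
open import Data.List.Membership.Propositional.Properties.WithK using (unique∧set⇒bag)
open import Data.List.Relation.Binary.BagAndSetEquality using (∼bag⇒↭)
open import Data.List.Relation.Binary.Permutation.Propositional.Properties using (↭-length)
open import Data.Rational using (ℚ; 0ℚ; _+_)
open import Data.Rational.Properties
  using (≤-refl; ≤-trans; ≤-reflexive; +-mono-≤; +-monoʳ-≤; +-identityˡ; +-assoc; ⊓-glb; p⊓q≤p; p⊓q≤q)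
open import Function.Bundles using (_⇔_; mk⇔)
open import Relation.Binary.Definitions using (DecidableEquality)
open import Relation.Binary.PropositionalEquality
  using (_≡_; _≢_; refl; sym; trans; cong; cong₂; subst; module ≡-Reasoning)
open import Relation.Nullary using (yes; no)

q≤p+q : ∀ {p q} → 0ℚ ≤ p → q ≤ p + q
q≤p+q {p} {q} 0≤p = subst (_≤ p + q) (+-identityˡ q) (+-mono-≤ 0≤p (≤-refl {q}))

Fin1-≡zero : (u : Fin 1) → u ≡ F.zero
Fin1-≡zero F.zero = refl

unique∧set⇒length≡ : {A : Set} {xs ys : List A} → Unique xs → Unique ys →
  (∀ {z} → z ∈ xs ⇔ z ∈ ys) → length xs ≡ length ys
unique∧set⇒length≡ uxs uys xs≈ys = ↭-length (∼bag⇒↭ (unique∧set⇒bag uxs uys xs≈ys))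

minFin≤ : ∀ {m} (g : Fin (suc m) → ℚ) i → minFin g ≤ g i
minFin≤ {ℕ.zero} g F.zero    = ≤-refl
minFin≤ {suc m}  g F.zero    = p⊓q≤p (g F.zero) _
minFin≤ {suc m}  g (F.suc i) = ≤-trans (p⊓q≤q (g F.zero) _) (minFin≤ (λ j → g (F.suc j)) i)

minFin-glb : ∀ {m} (g : Fin (suc m) → ℚ) {q} → (∀ i → q ≤ g i) → q ≤ minFin g
minFin-glb {ℕ.zero} g q≤g = q≤g F.zero
minFin-glb {suc m}  g q≤g = ⊓-glb (q≤g F.zero) (minFin-glb (λ j → g (F.suc j)) (λ j → q≤g (F.suc j)))

module _ {A : Set} {T : List (A × A)} where

  Adjacent-sym : ∀ {x y} → Adjacent T x y → Adjacent T y x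
  Adjacent-sym (inj₁ xy) = inj₂ xy
  Adjacent-sym (inj₂ yx) = inj₁ yx

  Reach-snoc : ∀ {x y z} → Reach T x y → Adjacent T y z → Reach T x z
  Reach-snoc here         yz = step yz here
  Reach-snoc (step xw wy) yz = step xw (Reach-snoc wy yz)

  Reach-trans : ∀ {x y z} → Reach T x y → Reach T y z → Reach T x z
  Reach-trans here         yz = yz
  Reach-trans (step xw wy) yz = step xw (Reach-trans wy yz)

  Reach-sym : ∀ {x y} → Reach T x y → Reach T y x
  Reach-sym here         = here
  Reach-sym (step xw wy) = Reach-snoc (Reach-sym wy) (Adjacent-sym xw)

walkCost-map-≤ : {A B : Set} (c : A → A → ℚ) (c' : B → B → ℚ) (g : A → B) →
  (∀ x y → c' (g x) (g y) ≤ c x y) → ∀ xs → walkCost c' (map g xs) ≤ walkCost c xs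
walkCost-map-≤ c c' g c'≤c []           = ≤-refl
walkCost-map-≤ c c' g c'≤c (x ∷ [])     = ≤-refl
walkCost-map-≤ c c' g c'≤c (x ∷ y ∷ xs) = +-mono-≤ (c'≤c x y) (walkCost-map-≤ c c' g c'≤c (y ∷ xs))

edgesOf : {A : Set} → List A → List (A × A)
edgesOf []           = []
edgesOf (x ∷ [])     = []
edgesOf (x ∷ y ∷ xs) = (x , y) ∷ edgesOf (y ∷ xs)

walkCost≡treeCost-edgesOf : {A : Set} (c : A → A → ℚ) (xs : List A) → walkCost c xs ≡ treeCost c (edgesOf xs)
walkCost≡treeCost-edgesOf c []           = refl
walkCost≡treeCost-edgesOf c (x ∷ [])     = refl
walkCost≡treeCost-edgesOf c (x ∷ y ∷ xs) = cong (c x y +_) (walkCost≡treeCost-edgesOf c (y ∷ xs))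

treeCost-++ : {A : Set} (c : A → A → ℚ) (P Q : List (A × A)) → treeCost c (P ++ Q) ≡ treeCost c P + treeCost c Q
treeCost-++ c []            Q = sym (+-identityˡ _)
treeCost-++ c ((x , y) ∷ P) Q = begin
  c x y + treeCost c (P ++ Q)              ≡⟨ cong (c x y +_) (treeCost-++ c P Q) ⟩
  c x y + (treeCost c P + treeCost c Q)    ≡⟨ sym (+-assoc (c x y) _ _) ⟩
  c x y + treeCost c P + treeCost c Q      ∎
  where open ≡-Reasoning

treeCost-mono-⊆ : {A : Set} {c : A → A → ℚ} → (∀ x y → 0ℚ ≤ c x y) →
  ∀ {P Q} → P ⊆ Q → treeCost c P ≤ treeCost c Q
treeCost-mono-⊆ c≥0 []         = ≤-refl
treeCost-mono-⊆ c≥0 (_ ∷ʳ P⊆Q) = ≤-trans (treeCost-mono-⊆ c≥0 P⊆Q) (q≤p+q (c≥0 _ _))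
treeCost-mono-⊆ {c = c} c≥0 (_∷_ {x = x , y} refl P⊆Q) = +-monoʳ-≤ (c x y) (treeCost-mono-⊆ c≥0 P⊆Q)

Loopless : {A : Set} → A × A → Set
Loopless (x , y) = x ≢ y

edgesOf-loopless : {A : Set} (xs : List A) → StepsDistinct xs → All Loopless (edgesOf xs)
edgesOf-loopless []           _           = []
edgesOf-loopless (x ∷ [])     _           = []
edgesOf-loopless (x ∷ y ∷ xs) (x≢y , sd) = x≢y ∷ edgesOf-loopless (y ∷ xs) sd

∈⇒edgeInto : {A : Set} (z : A) (xs : List A) {y : A} → y ∈ xs → ∃ λ x → (x , y) ∈ edgesOf (z ∷ xs)
∈⇒edgeInto z (y ∷ xs) (here refl) = z , here refl
∈⇒edgeInto z (y ∷ xs) (there y∈xs) with ∈⇒edgeInto y xs y∈xs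
... | x , xy∈ = x , there xy∈

-- Every tail of an edge list is in s or the head of an earlier edge.
TailsSeen : {A : Set} → List A → List (A × A) → Set
TailsSeen s []            = ⊤
TailsSeen s ((x , y) ∷ P) = x ∈ s × TailsSeen (y ∷ s) P

TailsSeen-mono : {A : Set} {s s' : List A} (P : List (A × A)) → (∀ {z} → z ∈ s → z ∈ s') → TailsSeen s P → TailsSeen s' P
TailsSeen-mono []            s⊆s' _           = tt
TailsSeen-mono ((x , y) ∷ P) s⊆s' (x∈s , ts) = s⊆s' x∈s , TailsSeen-mono P y∷s⊆y∷s' ts
  where
  y∷s⊆y∷s' : ∀ {z} → z ∈ y ∷ _ → z ∈ y ∷ _
  y∷s⊆y∷s' (here z≡y) = here z≡y
  y∷s⊆y∷s' (there z∈s) = there (s⊆s' z∈s)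

TailsSeen-edgesOf : {A : Set} {s : List A} (x : A) (xs : List A) → x ∈ s → TailsSeen s (edgesOf (x ∷ xs))
TailsSeen-edgesOf x []       x∈s = tt
TailsSeen-edgesOf x (y ∷ xs) x∈s = x∈s , TailsSeen-edgesOf y xs (here refl)

TailsSeen-++ : {A : Set} {s : List A} (P Q : List (A × A)) → TailsSeen s P →
  (∀ {s'} → (∀ {z} → z ∈ s → z ∈ s') → TailsSeen s' Q) → TailsSeen s (P ++ Q)
TailsSeen-++ []            Q _           tsQ = tsQ (λ z∈s → z∈s)
TailsSeen-++ ((x , y) ∷ P) Q (x∈s , tsP) tsQ = x∈s , TailsSeen-++ P Q tsP (λ s⊆s' → tsQ (λ z∈s → s⊆s' (there z∈s)))

module FirstArrivals {A : Set} (_≟_ : DecidableEquality A) where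
  open import Data.List.Membership.DecPropositional _≟_ using (_∈?_)

  firstArrivals : List A → List (A × A) → List (A × A)
  firstArrivals s [] = []
  firstArrivals s ((x , y) ∷ P) with y ∈? s
  ... | yes _ = firstArrivals s P
  ... | no  _ = (x , y) ∷ firstArrivals (y ∷ s) P

  firstArrivals-⊆ : ∀ s P → firstArrivals s P ⊆ P
  firstArrivals-⊆ s [] = []
  firstArrivals-⊆ s ((x , y) ∷ P) with y ∈? s
  ... | yes _ = (x , y) ∷ʳ firstArrivals-⊆ s P
  ... | no  _ = refl ∷ firstArrivals-⊆ (y ∷ s) P

  heads-fresh : ∀ s P {z} → z ∈ map proj₂ (firstArrivals s P) → z ∉ s
  heads-fresh s ((x , y) ∷ P) z∈ z∈s with y ∈? s
  heads-fresh s ((x , y) ∷ P) z∈         z∈s | yes _ = heads-fresh s P z∈ z∈s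
  heads-fresh s ((x , y) ∷ P) (here refl) z∈s | no y∉s = y∉s z∈s
  heads-fresh s ((x , y) ∷ P) (there z∈) z∈s | no _   = heads-fresh (y ∷ s) P z∈ (there z∈s)

  heads-unique : ∀ s P → Unique (map proj₂ (firstArrivals s P))
  heads-unique s [] = []
  heads-unique s ((x , y) ∷ P) with y ∈? s
  ... | yes _ = heads-unique s P
  ... | no  _ = All.tabulate (λ z∈ z≡y → heads-fresh (y ∷ s) P z∈ (here (sym z≡y))) ∷ heads-unique (y ∷ s) P

  heads-cover : ∀ s P {x y} → (x , y) ∈ P → y ∈ s ⊎ y ∈ map proj₂ (firstArrivals s P)
  heads-cover s ((x' , y') ∷ P) xy∈ with y' ∈? s
  heads-cover s ((x' , y') ∷ P) (here refl) | yes y∈s = inj₁ y∈s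
  heads-cover s ((x' , y') ∷ P) (there xy∈) | yes _   = heads-cover s P xy∈
  heads-cover s ((x' , y') ∷ P) (here refl) | no _    = inj₂ (here refl)
  heads-cover s ((x' , y') ∷ P) (there xy∈) | no _ with heads-cover (y' ∷ s) P xy∈
  ... | inj₁ (here y≡y') = inj₂ (here y≡y')
  ... | inj₁ (there y∈s) = inj₁ y∈s
  ... | inj₂ y∈heads     = inj₂ (there y∈heads)

  firstArrivals-reach : ∀ {T r} s P → (∀ {z} → z ∈ s → Reach T r z) →
    (∀ {e} → e ∈ firstArrivals s P → e ∈ T) → TailsSeen s P →
    ∀ {x y} → (x , y) ∈ P → Reach T r y
  firstArrivals-reach s ((x , y) ∷ P) reach-s kept⊆T (x∈s , ts) xy∈ with y ∈? s
  firstArrivals-reach s ((x , y) ∷ P) reach-s kept⊆T (x∈s , ts) (here refl) | yes y∈s = reach-s y∈s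
  firstArrivals-reach s ((x , y) ∷ P) reach-s kept⊆T (x∈s , ts) (there xy∈) | yes y∈s =
    firstArrivals-reach s P reach-s kept⊆T (TailsSeen-mono P y∷s⊆s ts) xy∈
    where
    y∷s⊆s : ∀ {z} → z ∈ y ∷ s → z ∈ s
    y∷s⊆s (here refl) = y∈s
    y∷s⊆s (there z∈s) = z∈s
  firstArrivals-reach s ((x , y) ∷ P) reach-s kept⊆T (x∈s , ts) (here refl) | no _ =
    Reach-snoc (reach-s x∈s) (inj₁ (kept⊆T (here refl)))
  firstArrivals-reach s ((x , y) ∷ P) reach-s kept⊆T (x∈s , ts) (there xy∈) | no _ =
    firstArrivals-reach (y ∷ s) P reach-y∷s (λ e∈ → kept⊆T (there e∈)) ts xy∈
    where
    reach-y∷s : ∀ {z} → z ∈ y ∷ s → Reach _ _ z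
    reach-y∷s (here refl) = Reach-snoc (reach-s x∈s) (inj₁ (kept⊆T (here refl)))
    reach-y∷s (there z∈s) = reach-s z∈s

module CollapseDepots {n m : ℕ} (I : Instance n (suc m))
  (nonneg : ∀ x y → 0ℚ ≤ w I x y) (symm : ∀ x y → w I x y ≡ w I y x) where

  collapse : Vtx n (suc m) → Vtx n 1
  collapse (inj₁ v) = inj₁ v
  collapse (inj₂ _) = inj₂ F.zero

  cH-collapse≤w : ∀ x y → cH I (collapse x) (collapse y) ≤ w I x y
  cH-collapse≤w (inj₁ v) (inj₁ v') = p⊓q≤q (cO I v + cO I v') _
  cH-collapse≤w (inj₁ v) (inj₂ u)  =
    subst (cO I v ≤_) (symm (inj₂ u) (inj₁ v)) (minFin≤ (λ u → w I (inj₂ u) (inj₁ v)) u)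
  cH-collapse≤w (inj₂ u) (inj₁ v)  = minFin≤ (λ u → w I (inj₂ u) (inj₁ v)) u
  cH-collapse≤w (inj₂ u) (inj₂ u') = nonneg _ _

  OnlyDepot : Fin (suc m) → Vtx n (suc m) → Set
  OnlyDepot u₀ x = ∀ u → x ≡ inj₂ u → u ≡ u₀

  collapse-≢ : ∀ {u₀} x y → OnlyDepot u₀ x → OnlyDepot u₀ y → x ≢ y → collapse x ≢ collapse y
  collapse-≢ (inj₁ v) (inj₁ v') _ _ v≢v' eq = v≢v' (cong inj₁ (inj₁-injective eq))
  collapse-≢ (inj₂ u) (inj₂ u') u≡ u'≡ u≢u' _ = u≢u' (cong inj₂ (trans (u≡ u refl) (sym (u'≡ u' refl))))

  StepsDistinct-collapse : ∀ {u₀} xs → All (OnlyDepot u₀) xs → StepsDistinct xs → StepsDistinct (map collapse xs)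
  StepsDistinct-collapse []           _                 _          = tt
  StepsDistinct-collapse (x ∷ [])     _                 _          = tt
  StepsDistinct-collapse (x ∷ y ∷ xs) (ox ∷ oy ∷ oxs) (x≢y , sd) =
    collapse-≢ x y ox oy x≢y , StepsDistinct-collapse (y ∷ xs) (oy ∷ oxs) sd

  collapse-walkOf : (t : Tour n (suc m) (k I)) →
    map collapse (walkOf t) ≡ inj₂ F.zero ∷ map collapse (inner t) ++ [ inj₂ F.zero ]
  collapse-walkOf t = cong (inj₂ F.zero ∷_) (map-++ collapse (inner t) [ inj₂ (depot t) ])

  walkOf-OnlyDepot : (t : Tour n (suc m) (k I)) → All (OnlyDepot (depot t)) (walkOf t)
  walkOf-OnlyDepot t = isDepot ∷ ++⁺ (noOtherDepot t) (isDepot ∷ [])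
    where
    isDepot : OnlyDepot (depot t) (inj₂ (depot t))
    isDepot _ refl = refl

  collapseTour : Tour n (suc m) (k I) → Tour n 1 (k I)
  collapseTour t = record
    { depot        = F.zero
    ; inner        = map collapse (inner t)
    ; del          = del t
    ; noOtherDepot = All.tabulate (λ _ u _ → Fin1-≡zero u)
    ; isWalk       = subst StepsDistinct (collapse-walkOf t)
                       (StepsDistinct-collapse (walkOf t) (walkOf-OnlyDepot t) (isWalk t))
    ; delVisited   = λ v del≢0 → ∈-map⁺ collapse (delVisited t v del≢0)
    ; capacity     = capacity t
    }

  collapseTour-cost : ∀ t → walkCost (cH I) (walkOf (collapseTour t)) ≤ walkCost (w I) (walkOf t)
  collapseTour-cost t = subst (_≤ walkCost (w I) (walkOf t)) (cong (walkCost (cH I)) (collapse-walkOf t))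
    (walkCost-map-≤ (w I) (cH I) collapse cH-collapse≤w (walkOf t))

  collapse-cost : ∀ S → cost (HInst I) (map collapseTour S) ≤ cost I S
  collapse-cost []      = ≤-refl
  collapse-cost (t ∷ S) = +-mono-≤ (collapseTour-cost t) (collapse-cost S)

  collapse-delivered : ∀ S v → sumℕ (map (λ t → del t v) (map collapseTour S)) ≡ sumℕ (map (λ t → del t v) S)
  collapse-delivered []      v = refl
  collapse-delivered (t ∷ S) v = cong (del t v ℕ.+_) (collapse-delivered S v)

  collapse-servedBySingleTour : ∀ S v → Any (λ t → del t v ≡ d I v) S → Any (λ t → del t v ≡ d I v) (map collapseTour S)
  collapse-servedBySingleTour (t ∷ S) v (here p)  = here p
  collapse-servedBySingleTour (t ∷ S) v (there p) = there (collapse-servedBySingleTour S v p)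

  collapse-feasible : ∀ {ver} S → Feasible ver I S → Feasible ver (HInst I) (map collapseTour S)
  collapse-feasible S (meets , single) =
    (λ v → trans (collapse-delivered S v) (meets v)) ,
    (λ unspl v → collapse-servedBySingleTour S v (single unspl v))

module TreeOfSolution {n m : ℕ} (I : Instance n (suc m)) (nonneg : ∀ x y → 0ℚ ≤ w I x y) where
  open FirstArrivals {Vtx n 1} (≡-dec F._≟_ F._≟_)

  o : Vtx n 1
  o = inj₂ F.zero

  cO-nonneg : ∀ v → 0ℚ ≤ cO I v
  cO-nonneg v = minFin-glb (λ u → w I (inj₂ u) (inj₁ v)) (λ u → nonneg _ _)

  cH-nonneg : ∀ x y → 0ℚ ≤ cH I x y
  cH-nonneg (inj₁ v) (inj₁ v') =
    ⊓-glb (subst (_≤ cO I v + cO I v') (+-identityˡ 0ℚ) (+-mono-≤ (cO-nonneg v) (cO-nonneg v'))) (nonneg _ _)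
  cH-nonneg (inj₁ v) (inj₂ _)  = cO-nonneg v
  cH-nonneg (inj₂ _) (inj₁ v)  = cO-nonneg v
  cH-nonneg (inj₂ _) (inj₂ _)  = ≤-refl

  allEdges : List (Tour n 1 (k I)) → List (Vtx n 1 × Vtx n 1)
  allEdges []      = []
  allEdges (t ∷ S) = edgesOf (walkOf t) ++ allEdges S

  cost≡treeCost-allEdges : ∀ S → cost (HInst I) S ≡ treeCost (cH I) (allEdges S)
  cost≡treeCost-allEdges []      = refl
  cost≡treeCost-allEdges (t ∷ S) =
    trans (cong₂ _+_ (walkCost≡treeCost-edgesOf (cH I) (walkOf t)) (cost≡treeCost-allEdges S))
          (sym (treeCost-++ (cH I) (edgesOf (walkOf t)) (allEdges S)))

  allEdges-loopless : ∀ S → All Loopless (allEdges S)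
  allEdges-loopless []      = []
  allEdges-loopless (t ∷ S) = ++⁺ (edgesOf-loopless (walkOf t) (isWalk t)) (allEdges-loopless S)

  -- Every tour starts at o.
  allEdges-TailsSeen : ∀ S {s} → o ∈ s → TailsSeen s (allEdges S)
  allEdges-TailsSeen []      o∈s = tt
  allEdges-TailsSeen (t ∷ S) o∈s =
    TailsSeen-++ (edgesOf (walkOf t)) (allEdges S)
      (TailsSeen-edgesOf (inj₂ (depot t)) _ (subst (λ u → inj₂ u ∈ _) (sym (Fin1-≡zero (depot t))) o∈s))
      (λ s⊆s' → allEdges-TailsSeen S (s⊆s' o∈s))

  delivered⇒edgeInto : ∀ S v → 1 ℕ.≤ sumℕ (map (λ t → del t v) S) → ∃ λ x → (x , inj₁ v) ∈ allEdges S
  delivered⇒edgeInto (t ∷ S) v delivered with del t v ℕ.≟ 0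
  ... | no del≢0 with ∈⇒edgeInto (inj₂ (depot t)) (inner t ++ [ inj₂ (depot t) ]) (∈-++⁺ˡ (delVisited t v del≢0))
  ...   | x , xv∈ = x , ∈-++⁺ˡ xv∈
  delivered⇒edgeInto (t ∷ S) v delivered | yes del≡0
    with delivered⇒edgeInto S v (subst (λ q → 1 ℕ.≤ q ℕ.+ sumℕ (map (λ t → del t v) S)) del≡0 delivered)
  ... | x , xv∈ = x , ∈-++⁺ʳ (edgesOf (walkOf t)) xv∈

  demands-met⇒edgeInto : (∀ v → 1 ℕ.≤ d I v) → ∀ S → (∀ v → sumℕ (map (λ t → del t v) S) ≡ d I v) →
    ∀ v → ∃ λ x → (x , inj₁ v) ∈ allEdges S
  demands-met⇒edgeInto d≥1 S meets v = delivered⇒edgeInto S v (subst (1 ℕ.≤_) (sym (meets v)) (d≥1 v))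

  treeOf : List (Tour n 1 (k I)) → List (Vtx n 1 × Vtx n 1)
  treeOf S = firstArrivals [ o ] (allEdges S)

  treeOf-cost : ∀ S → treeCost (cH I) (treeOf S) ≤ cost (HInst I) S
  treeOf-cost S = ≤-trans (treeCost-mono-⊆ cH-nonneg (firstArrivals-⊆ [ o ] (allEdges S)))
                          (≤-reflexive (sym (cost≡treeCost-allEdges S)))

  module _ (S : List (Tour n 1 (k I))) (visits : ∀ v → ∃ λ x → (x , inj₁ v) ∈ allEdges S) where

    treeOf-reach-o : ∀ z → Reach (treeOf S) o z
    treeOf-reach-o (inj₂ F.zero) = here
    treeOf-reach-o (inj₁ v)      =
      firstArrivals-reach [ o ] (allEdges S) (λ { (here refl) → here }) (λ e∈ → e∈)
        (allEdges-TailsSeen S (here refl)) (proj₂ (visits v))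

    -- The heads of the kept edges are exactly the customers, each once.
    treeOf-length : length (treeOf S) ≡ n
    treeOf-length = begin
      length (treeOf S)                  ≡⟨ sym (length-map proj₂ (treeOf S)) ⟩
      length (map proj₂ (treeOf S))      ≡⟨ unique∧set⇒length≡ (heads-unique [ o ] (allEdges S))
                                              (Unique-map⁺ inj₁-injective (allFin⁺ n)) (mk⇔ head⇒customer customer⇒head) ⟩
      length (map inj₁ (allFin n))       ≡⟨ length-map inj₁ (allFin n) ⟩
      length (allFin n)                  ≡⟨ length-tabulate (λ i → i) ⟩
      n                                  ∎
      where
      open ≡-Reasoning
      head⇒customer : ∀ {z} → z ∈ map proj₂ (treeOf S) → z ∈ map inj₁ (allFin n)
      head⇒customer {inj₁ v}      _  = ∈-map⁺ inj₁ (∈-allFin v)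
      head⇒customer {inj₂ F.zero} o∈ = ⊥-elim (heads-fresh [ o ] (allEdges S) o∈ (here refl))
      customer⇒head : ∀ {z} → z ∈ map inj₁ (allFin n) → z ∈ map proj₂ (treeOf S)
      customer⇒head z∈ with ∈-map⁻ inj₁ z∈
      ... | v , _ , refl with heads-cover [ o ] (allEdges S) (proj₂ (visits v))
      ...   | inj₁ (here ())
      ...   | inj₂ v∈heads = v∈heads

    treeOf-spanning : IsSpanningTree n (treeOf S)
    treeOf-spanning =
      All-resp-⊆ (firstArrivals-⊆ [ o ] (allEdges S)) (allEdges-loopless S) ,
      treeOf-length ,
      λ x y → Reach-trans (Reach-sym (treeOf-reach-o x)) (treeOf-reach-o y)

lemma3 : ∀ {n m : ℕ} (ver : Version) (I : Instance n (suc m)) →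
    ValidInstance ver I →
    ((S : Solution n (suc m) I) → Feasible ver I S →
      Σ (Solution n 1 (HInst I)) (λ S' →
        Feasible ver (HInst I) S' × (cost (HInst I) S' ≤ cost I S)))
    ×
    ((S' : Solution n 1 (HInst I)) → Feasible ver (HInst I) S' →
      (T : _) → IsMST I T → treeCost (cH I) T ≤ cost (HInst I) S')
lemma3 ver I valid =
  (λ S feasible → map collapseTour S , collapse-feasible S feasible , collapse-cost S) ,
  (λ S' (meets , _) T (_ , minimal) →
     ≤-trans (minimal (treeOf S') (treeOf-spanning S' (demands-met⇒edgeInto demand≥1 S' meets)))
             (treeOf-cost S'))
  where
  open ValidInstance valid
  open CollapseDepots I nonneg symm
  open TreeOfSolution I nonneg
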